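{- Let $k\geq3$ and $n$ be positive integers, let $V_{1},\dots,V_{k}$ be pairwise disjoint sets each of size $n$, and let $\Gamma=\{\{u,v\}:u\in V_{i},v\in V_{j},1\leq i<j\leq k\}$ be the edge set of the complete $k$-partite graph with parts $V_{1},\dots,V_{k}$. If $E\subseteq\Gamma$ is such that the graph $(V_{1}\cup\dots\cup V_{k},E)$ is $(k-1)$-colorable, then $|\Gamma\setminus E|\geq n^{2}$. -}

module Defs where

open import Data.Nat using (ℕ; _+_; _<ᵇ_)
open import Data.Bool using (Bool; true; false; if_then_else_; _∧_; not)
open import Data.Fin using (Fin; toℕ)
open import Data.List using (List; map; allFin; concatMap)
open import Data.Nat.ListAction using (sum)
open import Data.Product using (Σ; _×_; _,_; proj₁)
open import Relation.Binary.PropositionalEquality using (_≡_; _≢_)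

-- Vertices of the complete k-partite graph with parts V₁,…,V_k of size n:
-- the vertex (i , a) is the a-th element of part V_i.
Vertex : ℕ → ℕ → Set
Vertex k n = Fin k × Fin n

part : ∀ {k n} → Vertex k n → Fin k
part = proj₁

-- A subset E ⊆ Γ of the edges of the complete k-partite graph is given by
-- its indicator on pairs (u , v) with part u < part v; each unordered
-- edge {u,v} of Γ corresponds to exactly one such ordered pair, and the
-- values of E on other ordered pairs are ignored.
EdgeSet : ℕ → ℕ → Set
EdgeSet k n = Vertex k n → Vertex k n → Bool

crossᵇ : ∀ {k n} → Vertex k n → Vertex k n → Bool
crossᵇ u v = toℕ (part u) <ᵇ toℕ (part v)

ProperColouring : ∀ {k n c} → EdgeSet k n → (Vertex k n → Fin c) → Set
ProperColouring E col =
  ∀ u v → crossᵇ u v ≡ true → E u v ≡ true → col u ≢ col v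

Colourable : ∀ {k n} → ℕ → EdgeSet k n → Set
Colourable {k} {n} m E = Σ (Vertex k n → Fin m) (λ col → ProperColouring E col)

allVertices : (k n : ℕ) → List (Vertex k n)
allVertices k n = concatMap (λ i → map (λ a → (i , a)) (allFin n)) (allFin k)

missing : (k n : ℕ) → EdgeSet k n → ℕ
missing k n E =
  sum (map (λ u → sum (map (λ v → if crossᵇ u v ∧ not (E u v) then 1 else 0)
                           (allVertices k n)))
           (allVertices k n))

{-# OPTIONS --safe #-}
module Submission where

-- Let a proper colouring with m = k − 1 colours put x i c vertices of part i into colour c, and
-- let S c = ∑ᵢ x i c. Two vertices of the same colour in parts i < j cannot be joined in E, so
-- |Γ ∖ E| ≥ ∑_c ∑_{i<j} x i c · x j c. As x i c ≤ n, adding the parts one at a time shows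
-- ∑_{i<j} x i c · x j c ≥ n (S c ∸ n) for each colour, and since the k n vertices fall into
-- only k − 1 colours, ∑_c (S c ∸ n) ≥ n.

open import Defs
open import Data.Nat using (ℕ; _≤_; _∸_; _^_)
open import Data.Nat using (zero; suc; _+_; _*_; _<ᵇ_; z≤n)
open import Data.Nat.Properties
open import Algebra.Properties.Semiring.Sum +-*-semiring
  using ( sum; sum-syntax; sum-cong-≗; sum-replicate-zero; ∑-comm; ∑-distrib-+
        ; *-distribˡ-sum; *-distribʳ-sum )
open import Data.Bool using (true; false; if_then_else_; _∧_; not)
open import Data.Fin using (Fin; zero; suc; toℕ)
open import Data.List using (List; []; _∷_; _++_; map; concatMap; tabulate; allFin)
open import Data.List.Properties using (map-++; map-tabulate)
import Data.Nat.ListAction as List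
import Data.Nat.ListAction.Properties as List
open import Data.Product using (_,_)
open import Data.Sum using (inj₁; inj₂)
open import Function using (_∘_; id)
open import Relation.Binary.PropositionalEquality
  using (_≡_; _≢_; refl; sym; trans; cong; cong₂; module ≡-Reasoning)
open import Relation.Nullary using (contradiction)

sum-mono-≤ : ∀ {m} {f g : Fin m → ℕ} → (∀ i → f i ≤ g i) → sum f ≤ sum g
sum-mono-≤ {zero}  _   = z≤n
sum-mono-≤ {suc m} f≤g = +-mono-≤ (f≤g zero) (sum-mono-≤ (f≤g ∘ suc))

sum-const : ∀ m c → ∑[ i < m ] c ≡ m * c
sum-const zero    c = refl
sum-const (suc m) c = cong (c +_) (sum-const m c)

sum-map-tabulate : ∀ {A : Set} {m} (F : A → ℕ) (g : Fin m → A) →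
  List.sum (map F (tabulate g)) ≡ ∑[ i < m ] F (g i)
sum-map-tabulate {m = zero}  F g = refl
sum-map-tabulate {m = suc m} F g = cong (F (g zero) +_) (sum-map-tabulate F (g ∘ suc))

sum-map-concatMap : ∀ {A B : Set} (F : B → ℕ) (g : A → List B) xs →
  List.sum (map F (concatMap g xs)) ≡ List.sum (map (List.sum ∘ map F ∘ g) xs)
sum-map-concatMap F g []       = refl
sum-map-concatMap F g (x ∷ xs) = begin
  List.sum (map F (g x ++ concatMap g xs))
    ≡⟨ cong List.sum (map-++ F (g x) (concatMap g xs)) ⟩
  List.sum (map F (g x) ++ map F (concatMap g xs))
    ≡⟨ List.sum-++ (map F (g x)) (map F (concatMap g xs)) ⟩
  List.sum (map F (g x)) + List.sum (map F (concatMap g xs))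
    ≡⟨ cong (List.sum (map F (g x)) +_) (sum-map-concatMap F g xs) ⟩
  List.sum (map F (g x)) + List.sum (map (List.sum ∘ map F ∘ g) xs) ∎
  where open ≡-Reasoning

sum-allVertices : ∀ k n (F : Vertex k n → ℕ) →
  List.sum (map F (allVertices k n)) ≡ ∑[ i < k ] ∑[ a < n ] F (i , a)
sum-allVertices k n F = begin
  List.sum (map F (allVertices k n))
    ≡⟨ sum-map-concatMap F row (allFin k) ⟩
  List.sum (map (List.sum ∘ map F ∘ row) (tabulate id))
    ≡⟨ sum-map-tabulate (List.sum ∘ map F ∘ row) id ⟩
  ∑[ i < k ] List.sum (map F (row i))
    ≡⟨ sum-cong-≗ sum-row ⟩
  ∑[ i < k ] ∑[ a < n ] F (i , a) ∎
  where
    open ≡-Reasoning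
    row : Fin k → List (Vertex k n)
    row i = map (i ,_) (allFin n)
    sum-row : ∀ i → List.sum (map F (row i)) ≡ ∑[ a < n ] F (i , a)
    sum-row i = trans (cong (List.sum ∘ map F) (map-tabulate id (i ,_))) (sum-map-tabulate F (i ,_))

δ : ∀ {m} → Fin m → Fin m → ℕ
δ zero    zero    = 1
δ zero    (suc _) = 0
δ (suc _) zero    = 0
δ (suc c) (suc d) = δ c d

δ≤1 : ∀ {m} (c d : Fin m) → δ c d ≤ 1
δ≤1 zero    zero    = ≤-refl
δ≤1 zero    (suc _) = z≤n
δ≤1 (suc _) zero    = z≤n
δ≤1 (suc c) (suc d) = δ≤1 c d

c≢d⇒δ≡0 : ∀ {m} {c d : Fin m} → c ≢ d → δ c d ≡ 0
c≢d⇒δ≡0 {c = zero}  {zero}  c≢d = contradiction refl c≢d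
c≢d⇒δ≡0 {c = zero}  {suc _} _   = refl
c≢d⇒δ≡0 {c = suc _} {zero}  _   = refl
c≢d⇒δ≡0 {c = suc _} {suc _} c≢d = c≢d⇒δ≡0 (c≢d ∘ cong suc)

∑δ*F≡F : ∀ {m} (u : Fin m) (F : Fin m → ℕ) → ∑[ c < m ] (δ c u * F c) ≡ F u
∑δ*F≡F {suc m} zero    F =
  trans (cong₂ _+_ (+-identityʳ (F zero)) (sum-replicate-zero m)) (+-identityʳ (F zero))
∑δ*F≡F {suc m} (suc u) F = ∑δ*F≡F u (F ∘ suc)

∑δ≡1 : ∀ {m} (u : Fin m) → ∑[ c < m ] δ c u ≡ 1
∑δ≡1 u = trans (sum-cong-≗ (λ c → sym (*-identityʳ (δ c u)))) (∑δ*F≡F u (λ _ → 1))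

fibreSize : ∀ {n m} → (Fin n → Fin m) → Fin m → ℕ
fibreSize {n} f c = ∑[ a < n ] δ c (f a)

fibreSize≤ : ∀ {n m} (f : Fin n → Fin m) c → fibreSize f c ≤ n
fibreSize≤ {n} f c = begin
  fibreSize f c  ≤⟨ sum-mono-≤ (λ a → δ≤1 c (f a)) ⟩
  ∑[ a < n ] 1   ≡⟨ sum-const n 1 ⟩
  n * 1          ≡⟨ *-identityʳ n ⟩
  n              ∎
  where open ≤-Reasoning

∑-fibreSize : ∀ {n m} (f : Fin n → Fin m) → ∑[ c < m ] fibreSize f c ≡ n
∑-fibreSize {n} {m} f = begin
  ∑[ c < m ] ∑[ a < n ] δ c (f a)  ≡⟨ ∑-comm (λ c a → δ c (f a)) ⟩
  ∑[ a < n ] ∑[ c < m ] δ c (f a)  ≡⟨ sum-cong-≗ (∑δ≡1 ∘ f) ⟩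
  ∑[ a < n ] 1                     ≡⟨ sum-const n 1 ⟩
  n * 1                            ≡⟨ *-identityʳ n ⟩
  n                                ∎
  where open ≡-Reasoning

∑∑δ≡∑fibreSize* : ∀ {n n′ m} (f : Fin n → Fin m) (g : Fin n′ → Fin m) →
  ∑[ a < n ] ∑[ b < n′ ] δ (f a) (g b) ≡ ∑[ c < m ] (fibreSize f c * fibreSize g c)
∑∑δ≡∑fibreSize* {n} {n′} {m} f g = sym (begin
  ∑[ c < m ] (fibreSize f c * fibreSize g c)
    ≡⟨ sum-cong-≗ (λ c → *-distribʳ-sum (fibreSize g c) (λ a → δ c (f a))) ⟩
  ∑[ c < m ] ∑[ a < n ] (δ c (f a) * fibreSize g c)
    ≡⟨ sum-cong-≗ (λ c → sum-cong-≗ (λ a →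
         *-distribˡ-sum (δ c (f a)) (λ b → δ c (g b)))) ⟩
  ∑[ c < m ] ∑[ a < n ] ∑[ b < n′ ] (δ c (f a) * δ c (g b))
    ≡⟨ ∑-comm (λ c a → ∑[ b < n′ ] (δ c (f a) * δ c (g b))) ⟩
  ∑[ a < n ] ∑[ c < m ] ∑[ b < n′ ] (δ c (f a) * δ c (g b))
    ≡⟨ sum-cong-≗ (λ a → ∑-comm (λ c b → δ c (f a) * δ c (g b))) ⟩
  ∑[ a < n ] ∑[ b < n′ ] ∑[ c < m ] (δ c (f a) * δ c (g b))
    ≡⟨ sum-cong-≗ (λ a → sum-cong-≗ (λ b → ∑δ*F≡F (f a) (λ c → δ c (g b)))) ⟩
  ∑[ a < n ] ∑[ b < n′ ] δ (f a) (g b) ∎)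
  where open ≡-Reasoning

n≤∑[x∸n] : ∀ {m} n (x : Fin m → ℕ) → sum x ≡ suc m * n → n ≤ ∑[ c < m ] (x c ∸ n)
n≤∑[x∸n] {m} n x ∑x≡[1+m]n = +-cancelˡ-≤ (m * n) n (∑[ c < m ] (x c ∸ n)) (begin
  m * n + n                            ≡⟨ +-comm (m * n) n ⟩
  suc m * n                            ≡⟨ ∑x≡[1+m]n ⟨
  sum x                                ≤⟨ sum-mono-≤ (λ c → m≤n+m∸n (x c) n) ⟩
  ∑[ c < m ] (n + (x c ∸ n))           ≡⟨ ∑-distrib-+ (λ _ → n) (λ c → x c ∸ n) ⟩
  ∑[ c < m ] n + ∑[ c < m ] (x c ∸ n)  ≡⟨ cong (_+ ∑[ c < m ] (x c ∸ n)) (sum-const m n) ⟩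
  m * n + ∑[ c < m ] (x c ∸ n)         ∎)
  where open ≤-Reasoning

before : ∀ {k} → Fin k → Fin k → ℕ
before i j = if toℕ i <ᵇ toℕ j then 1 else 0

pairSum : ∀ {k} → (Fin k → Fin k → ℕ) → ℕ
pairSum {k} f = ∑[ i < k ] ∑[ j < k ] (before i j * f i j)

pairSum-cong : ∀ {k} {f g : Fin k → Fin k → ℕ} → (∀ i j → f i j ≡ g i j) →
  pairSum f ≡ pairSum g
pairSum-cong f≡g = sum-cong-≗ (λ i → sum-cong-≗ (λ j → cong (before i j *_) (f≡g i j)))

pairSum-suc : ∀ {k} (f : Fin (suc k) → Fin (suc k) → ℕ) →
  pairSum f ≡ ∑[ j < k ] f zero (suc j) + pairSum (λ i j → f (suc i) (suc j))
pairSum-suc f =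
  cong (_+ pairSum (λ i j → f (suc i) (suc j))) (sum-cong-≗ (λ j → +-identityʳ (f zero (suc j))))

pairSum-∑ : ∀ {k m} (f : Fin m → Fin k → Fin k → ℕ) →
  pairSum (λ i j → ∑[ c < m ] f c i j) ≡ ∑[ c < m ] pairSum (f c)
pairSum-∑ {k} {m} f = begin
  ∑[ i < k ] ∑[ j < k ] (before i j * ∑[ c < m ] f c i j)
    ≡⟨ sum-cong-≗ (λ i → sum-cong-≗ (λ j → *-distribˡ-sum (before i j) (λ c → f c i j))) ⟩
  ∑[ i < k ] ∑[ j < k ] ∑[ c < m ] (before i j * f c i j)
    ≡⟨ sum-cong-≗ (λ i → ∑-comm (λ j c → before i j * f c i j)) ⟩
  ∑[ i < k ] ∑[ c < m ] ∑[ j < k ] (before i j * f c i j)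
    ≡⟨ ∑-comm (λ i c → ∑[ j < k ] (before i j * f c i j)) ⟩
  ∑[ c < m ] ∑[ i < k ] ∑[ j < k ] (before i j * f c i j) ∎
  where open ≡-Reasoning

-- When s ≤ n this is (n − x) (n − s) ≥ 0.
n*[x+s∸n]≤x*s+n*[s∸n] : ∀ {n x} s → x ≤ n → n * (x + s ∸ n) ≤ x * s + n * (s ∸ n)
n*[x+s∸n]≤x*s+n*[s∸n] {n} {x} s x≤n with ≤-total n s
... | inj₁ n≤s = begin
  n * (x + s ∸ n)      ≡⟨ cong (n *_) (+-∸-assoc x n≤s) ⟩
  n * (x + (s ∸ n))    ≡⟨ *-distribˡ-+ n x (s ∸ n) ⟩
  n * x + n * (s ∸ n)  ≤⟨ +-monoˡ-≤ (n * (s ∸ n)) (*-monoˡ-≤ x n≤s) ⟩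
  s * x + n * (s ∸ n)  ≡⟨ cong (_+ n * (s ∸ n)) (*-comm s x) ⟩
  x * s + n * (s ∸ n)  ∎
  where open ≤-Reasoning
... | inj₂ s≤n = begin
  n * (x + s ∸ n)              ≡⟨ cong (λ t → n * (x + s ∸ t)) (m+[n∸m]≡n s≤n) ⟨
  n * (x + s ∸ (s + (n ∸ s)))  ≡⟨ cong (n *_) (∸-+-assoc (x + s) s (n ∸ s)) ⟨
  n * (x + s ∸ s ∸ (n ∸ s))    ≡⟨ cong (λ t → n * (t ∸ (n ∸ s))) (m+n∸n≡m x s) ⟩
  n * (x ∸ (n ∸ s))            ≡⟨ *-distribˡ-∸ n x (n ∸ s) ⟩
  n * x ∸ n * (n ∸ s)          ≤⟨ ∸-monoʳ-≤ (n * x) (*-monoˡ-≤ (n ∸ s) x≤n) ⟩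
  n * x ∸ x * (n ∸ s)          ≡⟨ cong (_∸ x * (n ∸ s)) (*-comm n x) ⟩
  x * n ∸ x * (n ∸ s)          ≡⟨ *-distribˡ-∸ x n (n ∸ s) ⟨
  x * (n ∸ (n ∸ s))            ≡⟨ cong (x *_) (m∸[m∸n]≡n s≤n) ⟩
  x * s                        ≤⟨ m≤m+n (x * s) (n * (s ∸ n)) ⟩
  x * s + n * (s ∸ n)          ∎
  where open ≤-Reasoning

n*[∑x∸n]≤pairSum : ∀ {k} n (x : Fin k → ℕ) → (∀ i → x i ≤ n) →
  n * (sum x ∸ n) ≤ pairSum (λ i j → x i * x j)
n*[∑x∸n]≤pairSum {zero}  n x _   = ≤-reflexive (trans (cong (n *_) (0∸n≡0 n)) (*-zeroʳ n))
n*[∑x∸n]≤pairSum {suc k} n x x≤n = begin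
  n * (x zero + s ∸ n)
    ≤⟨ n*[x+s∸n]≤x*s+n*[s∸n] s (x≤n zero) ⟩
  x zero * s + n * (s ∸ n)
    ≤⟨ +-monoʳ-≤ (x zero * s) (n*[∑x∸n]≤pairSum n (x ∘ suc) (x≤n ∘ suc)) ⟩
  x zero * s + pairSum′
    ≡⟨ cong (_+ pairSum′) (*-distribˡ-sum (x zero) (x ∘ suc)) ⟩
  ∑[ j < k ] (x zero * x (suc j)) + pairSum′
    ≡⟨ pairSum-suc (λ i j → x i * x j) ⟨
  pairSum (λ i j → x i * x j) ∎
  where
    open ≤-Reasoning
    s : ℕ
    s = sum (x ∘ suc)
    pairSum′ : ℕ
    pairSum′ = pairSum (λ i j → x (suc i) * x (suc j))

isMissing : ∀ {k n} → EdgeSet k n → Vertex k n → Vertex k n → ℕ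
isMissing E u v = if crossᵇ u v ∧ not (E u v) then 1 else 0

missing≡∑isMissing : ∀ k n (E : EdgeSet k n) →
  missing k n E ≡ ∑[ i < k ] ∑[ a < n ] ∑[ j < k ] ∑[ b < n ] isMissing E (i , a) (j , b)
missing≡∑isMissing k n E =
  trans (sum-allVertices k n (λ u → List.sum (map (isMissing E u) (allVertices k n))))
        (sum-cong-≗ (λ i → sum-cong-≗ (λ a → sum-allVertices k n (isMissing E (i , a)))))

monochromatic⇒isMissing : ∀ {k n m} {E : EdgeSet k n} {col : Vertex k n → Fin m} →
  ProperColouring E col →
  ∀ u v → (if crossᵇ u v then 1 else 0) * δ (col u) (col v) ≤ isMissing E u v
monochromatic⇒isMissing {E = E} {col} proper u v with crossᵇ u v in cross | E u v in uv
... | false | _     = z≤n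
... | true  | false = ≤-trans (≤-reflexive (+-identityʳ _)) (δ≤1 (col u) (col v))
... | true  | true  = ≤-reflexive (trans (+-identityʳ _) (c≢d⇒δ≡0 (proper u v cross uv)))

monochromaticPairs≤missing : ∀ {k n m} {E : EdgeSet k n} {col : Vertex k n → Fin m} →
  ProperColouring E col →
  pairSum (λ i j → ∑[ a < n ] ∑[ b < n ] δ (col (i , a)) (col (j , b))) ≤ missing k n E
monochromaticPairs≤missing {k} {n} {E = E} {col} proper = begin
  ∑[ i < k ] ∑[ j < k ] (before i j * ∑[ a < n ] ∑[ b < n ] mono i j a b)
    ≡⟨ sum-cong-≗ (λ i → sum-cong-≗ (distrib i)) ⟩
  ∑[ i < k ] ∑[ j < k ] ∑[ a < n ] ∑[ b < n ] (before i j * mono i j a b)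
    ≡⟨ sum-cong-≗ (λ i → ∑-comm (λ j a → ∑[ b < n ] (before i j * mono i j a b))) ⟩
  ∑[ i < k ] ∑[ a < n ] ∑[ j < k ] ∑[ b < n ] (before i j * mono i j a b)
    ≤⟨ sum-mono-≤ (λ i → sum-mono-≤ (λ a → sum-mono-≤ (λ j → sum-mono-≤ (λ b →
         monochromatic⇒isMissing proper (i , a) (j , b))))) ⟩
  ∑[ i < k ] ∑[ a < n ] ∑[ j < k ] ∑[ b < n ] isMissing E (i , a) (j , b)
    ≡⟨ missing≡∑isMissing k n E ⟨
  missing k n E ∎
  where
    open ≤-Reasoning
    mono : Fin k → Fin k → Fin n → Fin n → ℕ
    mono i j a b = δ (col (i , a)) (col (j , b))
    distrib : ∀ i j → before i j * ∑[ a < n ] ∑[ b < n ] mono i j a b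
                    ≡ ∑[ a < n ] ∑[ b < n ] (before i j * mono i j a b)
    distrib i j = trans (*-distribˡ-sum (before i j) (λ a → ∑[ b < n ] mono i j a b))
                        (sum-cong-≗ (λ a → *-distribˡ-sum (before i j) (mono i j a)))

colourable⇒n^2≤missing : ∀ m n (E : EdgeSet (suc m) n) → Colourable m E →
  n ^ 2 ≤ missing (suc m) n E
colourable⇒n^2≤missing m n E (col , proper) = begin
  n ^ 2                                         ≡⟨ cong (n *_) (*-identityʳ n) ⟩
  n * n                                         ≤⟨ *-monoʳ-≤ n (n≤∑[x∸n] n S ∑S≡[1+m]n) ⟩
  n * ∑[ c < m ] (S c ∸ n)                      ≡⟨ *-distribˡ-sum n (λ c → S c ∸ n) ⟩
  ∑[ c < m ] (n * (S c ∸ n))                    ≤⟨ sum-mono-≤ perColour ⟩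
  ∑[ c < m ] pairSum (λ i j → x i c * x j c)    ≡⟨ pairSum-∑ (λ c i j → x i c * x j c) ⟨
  pairSum (λ i j → ∑[ c < m ] (x i c * x j c))  ≡⟨ pairSum-cong fibres ⟨
  pairSum (λ i j → ∑[ a < n ] ∑[ b < n ] δ (col (i , a)) (col (j , b)))
                                                ≤⟨ monochromaticPairs≤missing proper ⟩
  missing (suc m) n E                           ∎
  where
    open ≤-Reasoning
    x : Fin (suc m) → Fin m → ℕ
    x i = fibreSize (col ∘ (i ,_))
    S : Fin m → ℕ
    S c = ∑[ i < suc m ] x i c
    ∑S≡[1+m]n : sum S ≡ suc m * n
    ∑S≡[1+m]n = trans (∑-comm (λ c i → x i c))
                      (trans (sum-cong-≗ (λ i → ∑-fibreSize (col ∘ (i ,_)))) (sum-const (suc m) n))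
    perColour : ∀ c → n * (S c ∸ n) ≤ pairSum (λ i j → x i c * x j c)
    perColour c = n*[∑x∸n]≤pairSum n (λ i → x i c) (λ i → fibreSize≤ (col ∘ (i ,_)) c)
    fibres : ∀ i j →
      ∑[ a < n ] ∑[ b < n ] δ (col (i , a)) (col (j , b)) ≡ ∑[ c < m ] (x i c * x j c)
    fibres i j = ∑∑δ≡∑fibreSize* (col ∘ (i ,_)) (col ∘ (j ,_))

lemma4p3 : (k n : ℕ) → 3 ≤ k → 1 ≤ n → (E : EdgeSet k n) →
    Colourable (k ∸ 1) E → n ^ 2 ≤ missing k n E
lemma4p3 (suc m) n _ _ = colourable⇒n^2≤missing m n
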